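{- Let $a,\delta$ be positive integers with $a<\delta<2a$ and $\gcd(a,\delta)=1$, put $b=a+\delta$, $d=\delta-a$ and $h=(3\delta+a)a$. For $n\ge 0$ let $w_n = n + a\lfloor n/a\rfloor + b\lfloor n/\delta\rfloor$, $\mathcal W_0=\{w_n:n\ge 0\}$, and let $C=(\mathcal W_0-\delta)\cap\mathcal W_0=\{x\in\mathcal W_0 : x+\delta\in\mathcal W_0\}$. Then in one heap-period the number of elements of $C$ is $ad$; that is, for every integer $N\ge 0$, $|C\cap\{N,N+1,\dots,N+h-1\}| = ad$.
   Context: For $X\subseteq\mathbb N$ and $y\in\mathbb N$, $X-y=\{x-y : x\in X,\ x\ge y\}$. The sequence satisfies $w_{n+a\delta}=w_n+h$ for all $n\ge0$, so $h$ is the heap-period of $\mathcal W_0$. -}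

module Defs where

open import Data.Nat using (ℕ; _+_; _*_; _∸_; _≤_; _<_; NonZero)
open import Data.Nat.DivMod using (_/_)
open import Data.Product using (∃; _×_)
open import Data.List using (List; length)
open import Data.List.Membership.Propositional using (_∈_)
open import Data.List.Relation.Unary.Unique.Propositional using (Unique)
open import Function.Bundles using (_⇔_)
open import Relation.Binary.PropositionalEquality using (_≡_)

w : (a δ : ℕ) → .{{NonZero a}} → .{{NonZero δ}} → ℕ → ℕ
w a δ n = n + a * (n / a) + (a + δ) * (n / δ)

InW0 : (a δ : ℕ) → .{{NonZero a}} → .{{NonZero δ}} → ℕ → Set
InW0 a δ x = ∃ λ n → w a δ n ≡ x

InC : (a δ : ℕ) → .{{NonZero a}} → .{{NonZero δ}} → ℕ → Set
InC a δ x = InW0 a δ x × InW0 a δ (x + δ)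

HasCard : (ℕ → Set) → ℕ → Set
HasCard P k = ∃ λ (L : List ℕ) → Unique L × length L ≡ k × (∀ x → (x ∈ L) ⇔ P x)

module Submission where

-- Since w (n + 1) - w n = 1 + a [a ∣ n + 1] + b [δ ∣ n + 1], the increment from w n to w (n + k)
-- is k + a i + b j, where i and j count the multiples of a and of δ in (n, n + k].  As b > δ and
-- 2a > δ, an increment δ forces j = 0, i = 1 and k = d; so C is the image under w of those n for
-- which (n, n + d] contains a multiple of a but no multiple of δ, i.e. (n + d, n + δ] contains a
-- multiple of δ.  Since w is strictly increasing with w (n + δa) = w n + h, a window of h
-- consecutive values meets 𝒲₀ in the image of δa consecutive indices.  Writing n = q a + r with
-- r < a, exactly d residues r satisfy the condition on a, and for each of them the intervals
-- (q a + r + d, (q + 1) a + r + d], q < δ, tile (r + d, r + d + δa], which holds exactly a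
-- multiples of δ.

open import Defs
open import Algebra.Properties.CommutativeSemigroup using (interchange)
open import Data.Empty using (⊥-elim)
open import Data.List using (List; map; filter; applyUpTo; length)
open import Data.List.Membership.Propositional using (_∈_)
open import Data.List.Membership.Propositional.Properties
  using (∈-map⁺; ∈-map⁻; ∈-filter⁺; ∈-filter⁻; ∈-applyUpTo⁺; ∈-applyUpTo⁻)
open import Data.List.Properties using (length-map; filter-accept; filter-reject)
open import Data.List.Relation.Unary.Unique.Propositional using (Unique)
open import Data.List.Relation.Unary.Unique.Propositional.Properties using (map⁺; filter⁺; applyUpTo⁺₁)
open import Data.Nat
open import Data.Nat.DivMod
open import Data.Nat.Divisibility using (divides)
open import Data.Nat.GCD using (gcd)
open import Data.Nat.Properties
open import Data.Nat.Tactic.RingSolver using (solve-∀)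
open import Data.Product using (∃; _×_; _,_)
open import Data.Sum using (inj₁; inj₂)
open import Function using (_∘_)
open import Function.Bundles using (_⇔_; mk⇔; Equivalence)
open import Relation.Binary using (tri<; tri≈; tri>)
open import Relation.Binary.PropositionalEquality
open import Relation.Nullary using (yes; no)

∑ : ℕ → (ℕ → ℕ) → ℕ
∑ zero    f = 0
∑ (suc k) f = f 0 + ∑ k (f ∘ suc)

infixr 6.5 ∑
syntax ∑ k (λ i → e) = ∑[ i < k ] e

∑-cong : ∀ k {f g : ℕ → ℕ} → (∀ {i} → i < k → f i ≡ g i) → ∑ k f ≡ ∑ k g
∑-cong zero    eq = refl
∑-cong (suc k) eq = cong₂ _+_ (eq z<s) (∑-cong k (eq ∘ s<s))

∑-zero : ∀ k → ∑[ i < k ] 0 ≡ 0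
∑-zero zero    = refl
∑-zero (suc k) = ∑-zero k

∑-+ : ∀ m n (f : ℕ → ℕ) → ∑ (m + n) f ≡ ∑ m f + ∑[ i < n ] f (m + i)
∑-+ zero    n f = refl
∑-+ (suc m) n f = trans (cong (f 0 +_) (∑-+ m n (f ∘ suc))) (sym (+-assoc (f 0) _ _))

∑-distrib-+ : ∀ k (f g : ℕ → ℕ) → ∑[ i < k ] (f i + g i) ≡ ∑ k f + ∑ k g
∑-distrib-+ zero    f g = refl
∑-distrib-+ (suc k) f g =
  trans (cong (f 0 + g 0 +_) (∑-distrib-+ k (f ∘ suc) (g ∘ suc))) (interchange +-commutativeSemigroup (f 0) (g 0) _ _)

∑-*ˡ : ∀ k c (f : ℕ → ℕ) → ∑[ i < k ] c * f i ≡ c * ∑ k f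
∑-*ˡ zero    c f = sym (*-zeroʳ c)
∑-*ˡ (suc k) c f = trans (cong (c * f 0 +_) (∑-*ˡ k c (f ∘ suc))) (sym (*-distribˡ-+ c (f 0) _))

∑-swap : ∀ n m (F : ℕ → ℕ → ℕ) → ∑[ j < n ] ∑[ r < m ] F j r ≡ ∑[ r < m ] ∑[ j < n ] F j r
∑-swap zero    m F = sym (∑-zero m)
∑-swap (suc n) m F =
  trans (cong (∑ m (F 0) +_) (∑-swap n m (F ∘ suc))) (sym (∑-distrib-+ m (F 0) _))

∑-blocks : ∀ q a (f : ℕ → ℕ) → ∑ (q * a) f ≡ ∑[ j < q ] ∑[ r < a ] f (j * a + r)
∑-blocks zero    a f = refl
∑-blocks (suc q) a f = begin
  ∑ (a + q * a) f
    ≡⟨ ∑-+ a (q * a) f ⟩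
  ∑ a f + ∑[ i < q * a ] f (a + i)
    ≡⟨ cong (∑ a f +_) (∑-blocks q a (λ i → f (a + i))) ⟩
  ∑ a f + ∑[ j < q ] ∑[ r < a ] f (a + (j * a + r))
    ≡⟨ cong (∑ a f +_) (∑-cong q λ _ → ∑-cong a λ _ → cong f (sym (+-assoc a _ _))) ⟩
  ∑ a f + ∑[ j < q ] ∑[ r < a ] f (suc j * a + r) ∎
  where open ≡-Reasoning

∑-suc : ∀ k (f : ℕ → ℕ) → ∑ (suc k) f ≡ ∑ k f + f k
∑-suc k f = begin
  ∑ (suc k) f                 ≡⟨ cong (λ m → ∑ m f) (+-comm 1 k) ⟩
  ∑ (k + 1) f                 ≡⟨ ∑-+ k 1 f ⟩
  ∑ k f + (f (k + 0) + 0)     ≡⟨ cong (∑ k f +_) (trans (+-identityʳ (f (k + 0))) (cong f (+-identityʳ k))) ⟩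
  ∑ k f + f k                 ∎
  where open ≡-Reasoning

∑-periodic : ∀ P (f : ℕ → ℕ) → (∀ i → f (i + P) ≡ f i) → ∀ s → ∑[ i < P ] f (s + i) ≡ ∑ P f
∑-periodic P f periodic zero    = refl
∑-periodic P f periodic (suc s) = trans (+-cancelʳ-≡ (f s) _ _ rotate) (∑-periodic P f periodic s)
  where
  open ≡-Reasoning
  rotate : ∑[ i < P ] f (suc s + i) + f s ≡ ∑[ i < P ] f (s + i) + f s
  rotate = begin
    ∑[ i < P ] f (suc s + i) + f s
      ≡⟨ cong₂ _+_ (∑-cong P λ {i} _ → cong f (sym (+-suc s i))) (cong f (sym (+-identityʳ s))) ⟩
    ∑[ i < P ] f (s + suc i) + f (s + 0)
      ≡⟨ +-comm _ (f (s + 0)) ⟩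
    ∑[ i < suc P ] f (s + i)
      ≡⟨ ∑-suc P (λ i → f (s + i)) ⟩
    ∑[ i < P ] f (s + i) + f (s + P)
      ≡⟨ cong (∑[ i < P ] f (s + i) +_) (periodic s) ⟩
    ∑[ i < P ] f (s + i) + f s ∎

-- Δ D n k is the number of multiples of D in (n, n + k].
Δ : (D : ℕ) .{{_ : NonZero D}} → ℕ → ℕ → ℕ
Δ D n k = (n + k) / D ∸ n / D

[m+kn]/n≡m/n+k : ∀ m k n .{{_ : NonZero n}} → (m + k * n) / n ≡ m / n + k
[m+kn]/n≡m/n+k m k n = trans (+-distrib-/-∣ʳ m (divides k refl)) (cong (m / n +_) (m*n/n≡m k n))

module _ (D : ℕ) .{{_ : NonZero D}} where

  [n+k]/D≡n/D+Δ : ∀ n k → (n + k) / D ≡ n / D + Δ D n k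
  [n+k]/D≡n/D+Δ n k = sym (m+[n∸m]≡n (/-monoˡ-≤ D (m≤m+n n k)))

  Δ-zero : ∀ n → Δ D n 0 ≡ 0
  Δ-zero n = trans (cong (λ m → m / D ∸ n / D) (+-identityʳ n)) (n∸n≡0 (n / D))

  Δ-split : ∀ n k l → Δ D n (k + l) ≡ Δ D n k + Δ D (n + k) l
  Δ-split n k l = +-cancelˡ-≡ (n / D) _ _ (begin
    n / D + Δ D n (k + l)                  ≡⟨ [n+k]/D≡n/D+Δ n (k + l) ⟨
    (n + (k + l)) / D                      ≡⟨ cong (_/ D) (+-assoc n k l) ⟨
    (n + k + l) / D                        ≡⟨ [n+k]/D≡n/D+Δ (n + k) l ⟩
    (n + k) / D + Δ D (n + k) l            ≡⟨ cong (_+ Δ D (n + k) l) ([n+k]/D≡n/D+Δ n k) ⟩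
    n / D + Δ D n k + Δ D (n + k) l        ≡⟨ +-assoc (n / D) _ _ ⟩
    n / D + (Δ D n k + Δ D (n + k) l)      ∎)
    where open ≡-Reasoning

  Δ-monoʳ-≤ : ∀ n {k l} → k ≤ l → Δ D n k ≤ Δ D n l
  Δ-monoʳ-≤ n {k} {l} k≤l = begin
    Δ D n k                          ≤⟨ m≤m+n _ _ ⟩
    Δ D n k + Δ D (n + k) (l ∸ k)    ≡⟨ Δ-split n k (l ∸ k) ⟨
    Δ D n (k + (l ∸ k))              ≡⟨ cong (Δ D n) (m+[n∸m]≡n k≤l) ⟩
    Δ D n l                          ∎
    where open ≤-Reasoning

  Δ-multiple : ∀ n m → Δ D n (m * D) ≡ m
  Δ-multiple n m = trans (cong (_∸ n / D) ([m+kn]/n≡m/n+k n m D)) (m+n∸m≡n (n / D) m)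

  Δ-self : ∀ n → Δ D n D ≡ 1
  Δ-self n = trans (cong (Δ D n) (sym (*-identityˡ D))) (Δ-multiple n 1)

  Δ-periodic : ∀ m n k → Δ D (m * D + n) k ≡ Δ D n k
  Δ-periodic m n k = begin
    (m * D + n + k) / D ∸ (m * D + n) / D
      ≡⟨ cong₂ (λ x y → x / D ∸ y / D) (shuffle (m * D) n k) (+-comm (m * D) n) ⟩
    (n + k + m * D) / D ∸ (n + m * D) / D
      ≡⟨ cong₂ _∸_ ([m+kn]/n≡m/n+k (n + k) m D) ([m+kn]/n≡m/n+k n m D) ⟩
    ((n + k) / D + m) ∸ (n / D + m)
      ≡⟨ cong₂ _∸_ (+-comm _ m) (+-comm _ m) ⟩
    (m + (n + k) / D) ∸ (m + n / D)
      ≡⟨ [m+n]∸[m+o]≡n∸o m _ _ ⟩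
    Δ D n k ∎
    where
    open ≡-Reasoning
    shuffle : ∀ x y z → x + y + z ≡ y + z + x
    shuffle = solve-∀

  Δ-blocks : ∀ m k x → ∑[ q < m ] Δ D (q * k + x) k ≡ Δ D x (m * k)
  Δ-blocks zero    k x = sym (Δ-zero x)
  Δ-blocks (suc m) k x = begin
    Δ D x k + ∑[ q < m ] Δ D (k + q * k + x) k
      ≡⟨ cong (Δ D x k +_) (∑-cong m λ {q} _ → cong (λ y → Δ D y k) (shuffle k (q * k) x)) ⟩
    Δ D x k + ∑[ q < m ] Δ D (q * k + (x + k)) k
      ≡⟨ cong (Δ D x k +_) (Δ-blocks m k (x + k)) ⟩
    Δ D x k + Δ D (x + k) (m * k)
      ≡⟨ Δ-split x k (m * k) ⟨
    Δ D x (k + m * k) ∎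
    where
    open ≡-Reasoning
    shuffle : ∀ a b c → a + b + c ≡ b + (c + a)
    shuffle = solve-∀

  ∑-Δ-residues : ∀ k → ∑[ r < D ] Δ D r k ≡ k
  ∑-Δ-residues zero    = trans (∑-cong D λ {r} _ → Δ-zero r) (∑-zero D)
  ∑-Δ-residues (suc k) = begin
    ∑[ r < D ] Δ D r (suc k)
      ≡⟨ ∑-cong D (λ {r} _ → trans (cong (Δ D r) (+-comm 1 k)) (Δ-split r k 1)) ⟩
    ∑[ r < D ] (Δ D r k + Δ D (r + k) 1)
      ≡⟨ ∑-distrib-+ D (λ r → Δ D r k) (λ r → Δ D (r + k) 1) ⟩
    ∑[ r < D ] Δ D r k + ∑[ r < D ] Δ D (r + k) 1
      ≡⟨ cong₂ _+_ (∑-Δ-residues k) (∑-cong D λ {r} _ → cong (λ y → Δ D y 1) (+-comm r k)) ⟩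
    k + ∑[ r < D ] Δ D (k + r) 1
      ≡⟨ cong (k +_) (∑-periodic D (λ r → Δ D r 1) Δ₁-periodic k) ⟩
    k + ∑[ r < D ] Δ D r 1
      ≡⟨ cong (k +_) one-per-period ⟩
    k + 1
      ≡⟨ +-comm k 1 ⟩
    suc k ∎
    where
    open ≡-Reasoning
    one-per-period : ∑[ r < D ] Δ D r 1 ≡ 1
    one-per-period = begin
      ∑[ r < D ] Δ D r 1
        ≡⟨ ∑-cong D (λ {r} _ → cong (λ y → Δ D y 1) (sym (trans (+-identityʳ (r * 1)) (*-identityʳ r)))) ⟩
      ∑[ r < D ] Δ D (r * 1 + 0) 1
        ≡⟨ Δ-blocks D 1 0 ⟩
      Δ D 0 (D * 1)
        ≡⟨ cong (Δ D 0) (*-comm D 1) ⟩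
      Δ D 0 (1 * D)
        ≡⟨ Δ-multiple 0 1 ⟩
      1 ∎
    Δ₁-periodic : ∀ r → Δ D (r + D) 1 ≡ Δ D r 1
    Δ₁-periodic r = trans (cong (λ y → Δ D y 1) (trans (+-comm r D) (cong (_+ r) (sym (*-identityˡ D))))) (Δ-periodic 1 r 1)

module StrictlyIncreasing (f : ℕ → ℕ) (f-< : ∀ {m n} → m < n → f m < f n) where

  mono : ∀ {m n} → m ≤ n → f m ≤ f n
  mono m≤n with m≤n⇒m<n∨m≡n m≤n
  ... | inj₁ m<n  = <⇒≤ (f-< m<n)
  ... | inj₂ refl = ≤-refl

  cancel-< : ∀ {m n} → f m < f n → m < n
  cancel-< fm<fn = ≰⇒> (λ n≤m → <⇒≱ fm<fn (mono n≤m))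

  injective : ∀ {m n} → f m ≡ f n → m ≡ n
  injective {m} {n} eq with <-cmp m n
  ... | tri< m<n _ _ = ⊥-elim (<-irrefl eq (f-< m<n))
  ... | tri≈ _ m≡n _ = m≡n
  ... | tri> _ _ n<m = ⊥-elim (<-irrefl (sym eq) (f-< n<m))

  first-reaching : ∀ N → ∃ λ m → (∀ n → n < m → f n < N) × N ≤ f m
  first-reaching zero = 0 , (λ _ ()) , z≤n
  first-reaching (suc N) with first-reaching N
  ... | m , below , reached with suc N ≤? f m
  ... | yes N<fm = m , (λ n n<m → m<n⇒m<1+n (below n n<m)) , N<fm
  ... | no  N≮fm = suc m , below′ , subst (_< f (suc m)) fm≡N (f-< (n<1+n m))
    where
    fm≡N : f m ≡ N
    fm≡N = ≤-antisym (≤-pred (≰⇒> N≮fm)) reached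
    below′ : ∀ n → n < suc m → f n < suc N
    below′ n n<1+m = s≤s (subst (f n ≤_) fm≡N (mono (≤-pred n<1+m)))

  threshold : ∀ N → ∃ λ m → ∀ n → f n < N ⇔ n < m
  threshold N with first-reaching N
  ... | m , below , reached = m , λ n →
    mk⇔ (λ fn<N → ≰⇒> (λ m≤n → <⇒≱ fn<N (≤-trans reached (mono m≤n)))) (below n)

  window : ∀ {P H} → f 0 ≡ 0 → (∀ n → f (n + P) ≡ f n + H) →
           ∀ N → ∃ λ m → ∀ n → (N ≤ f n × f n < N + H) ⇔ (m ≤ n × n < m + P)
  window {P} {H} f0≡0 periodic N with threshold N
  ... | m , th = m , λ n → mk⇔ (λ (N≤fn , fn<N+H) → Equivalence.to (lower n) N≤fn , Equivalence.to (upper n) fn<N+H)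
                               (λ (m≤n , n<m+P) → Equivalence.from (lower n) m≤n , Equivalence.from (upper n) n<m+P)
    where
    lower : ∀ n → N ≤ f n ⇔ m ≤ n
    lower n = mk⇔ (λ N≤fn → ≮⇒≥ (λ n<m → <⇒≱ (Equivalence.from (th n) n<m) N≤fn))
                  (λ m≤n → ≮⇒≥ (λ fn<N → <⇒≱ (Equivalence.to (th n) fn<N) m≤n))
    upper : ∀ n → f n < N + H ⇔ n < m + P
    upper n with P ≤? n
    ... | no P≰n = mk⇔ (λ _ → ≤-trans (≰⇒> P≰n) (m≤n+m P m))
                       (λ _ → <-≤-trans (f-< (≰⇒> P≰n)) (≤-trans (≤-reflexive (trans (periodic 0) (cong (_+ H) f0≡0))) (m≤n+m H N)))
    ... | yes P≤n with n ∸ P | m∸n+n≡m P≤n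
    ... | n′ | refl = mk⇔
      (λ lt → +-monoˡ-< P (Equivalence.to (th n′) (+-cancelʳ-< H _ _ (subst (_< N + H) (periodic n′) lt))))
      (λ lt → subst (_< N + H) (sym (periodic n′)) (+-monoˡ-< H (Equivalence.from (th n′) (+-cancelʳ-< P _ _ lt))))

length-filter-≡1 : (χ : ℕ → ℕ) → (∀ n → χ n ≤ 1) → ∀ k (f : ℕ → ℕ) →
                   length (filter (λ n → χ n ≟ 1) (applyUpTo f k)) ≡ ∑[ i < k ] χ (f i)
length-filter-≡1 χ χ≤1 zero    f = refl
length-filter-≡1 χ χ≤1 (suc k) f with χ (f 0) ≟ 1
... | yes χ≡1 = begin
  length (filter (λ n → χ n ≟ 1) (applyUpTo f (suc k)))
    ≡⟨ cong length (filter-accept (λ n → χ n ≟ 1) χ≡1) ⟩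
  suc (length (filter (λ n → χ n ≟ 1) (applyUpTo (f ∘ suc) k)))
    ≡⟨ cong suc (length-filter-≡1 χ χ≤1 k (f ∘ suc)) ⟩
  1 + ∑[ i < k ] χ (f (suc i))
    ≡⟨ cong (_+ ∑[ i < k ] χ (f (suc i))) (sym χ≡1) ⟩
  ∑[ i < suc k ] χ (f i) ∎
  where open ≡-Reasoning
... | no  χ≢1 = begin
  length (filter (λ n → χ n ≟ 1) (applyUpTo f (suc k)))   ≡⟨ cong length (filter-reject (λ n → χ n ≟ 1) χ≢1) ⟩
  length (filter (λ n → χ n ≟ 1) (applyUpTo (f ∘ suc) k)) ≡⟨ length-filter-≡1 χ χ≤1 k (f ∘ suc) ⟩
  0 + ∑[ i < k ] χ (f (suc i))                            ≡⟨ cong (_+ ∑[ i < k ] χ (f (suc i))) (sym χ≡0) ⟩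
  ∑[ i < suc k ] χ (f i)                                  ∎
  where
  open ≡-Reasoning
  χ≡0 : χ (f 0) ≡ 0
  χ≡0 = n<1⇒n≡0 (≤∧≢⇒< (χ≤1 (f 0)) χ≢1)

∈-applyUpTo-+ : ∀ m k n → n ∈ applyUpTo (m +_) k ⇔ (m ≤ n × n < m + k)
∈-applyUpTo-+ m k n = mk⇔ to from
  where
  to : n ∈ applyUpTo (m +_) k → m ≤ n × n < m + k
  to n∈ with ∈-applyUpTo⁻ (m +_) n∈
  ... | i , i<k , refl = m≤m+n m i , +-monoʳ-< m i<k
  from : m ≤ n × n < m + k → n ∈ applyUpTo (m +_) k
  from (m≤n , n<m+k) = subst (_∈ applyUpTo (m +_) k) (m+[n∸m]≡n m≤n)
    (∈-applyUpTo⁺ (m +_) (+-cancelˡ-< m _ _ (subst (_< m + k) (sym (m+[n∸m]≡n m≤n)) n<m+k)))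

module _ (a δ : ℕ) .{{_ : NonZero a}} .{{_ : NonZero δ}} where

  w-step : ∀ n k → w a δ (n + k) ≡ w a δ n + (k + a * Δ a n k + (a + δ) * Δ δ n k)
  w-step n k = begin
    n + k + a * ((n + k) / a) + (a + δ) * ((n + k) / δ)
      ≡⟨ cong₂ (λ x y → n + k + a * x + (a + δ) * y) ([n+k]/D≡n/D+Δ a n k) ([n+k]/D≡n/D+Δ δ n k) ⟩
    n + k + a * (n / a + Δ a n k) + (a + δ) * (n / δ + Δ δ n k)
      ≡⟨ regroup n k a (a + δ) (n / a) (n / δ) (Δ a n k) (Δ δ n k) ⟩
    w a δ n + (k + a * Δ a n k + (a + δ) * Δ δ n k) ∎
    where
    open ≡-Reasoning
    regroup : ∀ n k a b x y i j → n + k + a * (x + i) + b * (y + j) ≡ n + a * x + b * y + (k + a * i + b * j)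
    regroup = solve-∀

  w-strictMono : ∀ {m n} → m < n → w a δ m < w a δ n
  w-strictMono m<n = +-mono-<-≤ (+-mono-<-≤ m<n (*-monoʳ-≤ a (/-monoˡ-≤ a (<⇒≤ m<n))))
                                (*-monoʳ-≤ (a + δ) (/-monoˡ-≤ δ (<⇒≤ m<n)))

  w-zero : w a δ 0 ≡ 0
  w-zero = trans (cong₂ (λ x y → a * x + (a + δ) * y) (0/n≡0 a) (0/n≡0 δ))
                 (cong₂ _+_ (*-zeroʳ a) (*-zeroʳ (a + δ)))

  w-periodic : ∀ n → w a δ (n + δ * a) ≡ w a δ n + (3 * δ + a) * a
  w-periodic n = begin
    w a δ (n + δ * a)
      ≡⟨ w-step n (δ * a) ⟩
    w a δ n + (δ * a + a * Δ a n (δ * a) + (a + δ) * Δ δ n (δ * a))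
      ≡⟨ cong₂ (λ x y → w a δ n + (δ * a + a * x + (a + δ) * y)) (Δ-multiple a n δ) (trans (cong (Δ δ n) (*-comm δ a)) (Δ-multiple δ n a)) ⟩
    w a δ n + (δ * a + a * δ + (a + δ) * a)
      ≡⟨ cong (w a δ n +_) (period a δ) ⟩
    w a δ n + (3 * δ + a) * a ∎
    where
    open ≡-Reasoning
    period : ∀ a δ → δ * a + a * δ + (a + δ) * a ≡ (3 * δ + a) * a
    period = solve-∀

  -- For a < δ < 2a, χ n is 1 when (n, n + d] contains a multiple of a and (n + d, n + δ] one of δ,
  -- and 0 otherwise; by InC⇔ these n are exactly the indices of the elements of C.
  χ : ℕ → ℕ
  χ n = Δ a n (δ ∸ a) * Δ δ (n + (δ ∸ a)) a

  C-indices : ℕ → ℕ → List ℕ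
  C-indices m P = filter (λ n → χ n ≟ 1) (applyUpTo (m +_) P)

  χ-periodic : ∀ n → χ (n + δ * a) ≡ χ n
  χ-periodic n = cong₂ _*_
    (trans (cong (λ y → Δ a y (δ ∸ a)) (+-comm n (δ * a))) (Δ-periodic a δ n (δ ∸ a)))
    (trans (cong (λ y → Δ δ y a) (shuffle n δ a (δ ∸ a))) (Δ-periodic δ a (n + (δ ∸ a)) a))
    where
    shuffle : ∀ n δ a d → n + δ * a + d ≡ a * δ + (n + d)
    shuffle = solve-∀

  ∑-χ : ∑[ n < δ * a ] χ n ≡ a * (δ ∸ a)
  ∑-χ = begin
    ∑[ n < δ * a ] χ n
      ≡⟨ ∑-blocks δ a χ ⟩
    ∑[ q < δ ] ∑[ r < a ] χ (q * a + r)
      ≡⟨ ∑-swap δ a (λ q r → χ (q * a + r)) ⟩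
    ∑[ r < a ] ∑[ q < δ ] χ (q * a + r)
      ≡⟨ ∑-cong a (λ {r} _ → ∑-cong δ λ {q} _ → χ-residue q r) ⟩
    ∑[ r < a ] ∑[ q < δ ] Δ a r d * Δ δ (q * a + (r + d)) a
      ≡⟨ ∑-cong a (λ {r} _ → ∑-*ˡ δ (Δ a r d) _) ⟩
    ∑[ r < a ] Δ a r d * (∑[ q < δ ] Δ δ (q * a + (r + d)) a)
      ≡⟨ ∑-cong a (λ {r} _ → cong (Δ a r d *_) (column r)) ⟩
    ∑[ r < a ] Δ a r d * a
      ≡⟨ ∑-cong a (λ {r} _ → *-comm (Δ a r d) a) ⟩
    ∑[ r < a ] a * Δ a r d
      ≡⟨ ∑-*ˡ a a (λ r → Δ a r d) ⟩
    a * (∑[ r < a ] Δ a r d)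
      ≡⟨ cong (a *_) (∑-Δ-residues a d) ⟩
    a * d ∎
    where
    open ≡-Reasoning
    d = δ ∸ a
    χ-residue : ∀ q r → χ (q * a + r) ≡ Δ a r d * Δ δ (q * a + (r + d)) a
    χ-residue q r = cong₂ _*_ (Δ-periodic a q r d) (cong (λ y → Δ δ y a) (+-assoc (q * a) r d))
    column : ∀ r → ∑[ q < δ ] Δ δ (q * a + (r + d)) a ≡ a
    column r = trans (Δ-blocks δ δ a (r + d)) (trans (cong (Δ δ (r + d)) (*-comm δ a)) (Δ-multiple δ (r + d) a))

module _ (a δ : ℕ) .{{_ : NonZero a}} .{{_ : NonZero δ}} (a<δ : a < δ) (δ<2a : δ < 2 * a) where

  private
    d : ℕ
    d = δ ∸ a

    k+a*1+b*0≡k+a : ∀ k a b → k + a * 1 + b * 0 ≡ k + a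
    k+a*1+b*0≡k+a = solve-∀

  d+a≡δ : d + a ≡ δ
  d+a≡δ = m∸n+n≡m (<⇒≤ a<δ)

  d≤a : d ≤ a
  d≤a = m≤n+o⇒m∸n≤o δ a (subst (λ y → δ ≤ a + y) (+-identityʳ a) (<⇒≤ δ<2a))

  step≡δ⇒ : ∀ k i j → (a ≤ k → 1 ≤ i) → k + a * i + (a + δ) * j ≡ δ → k ≡ d × i ≡ 1 × j ≡ 0
  step≡δ⇒ k i (suc j) _ eq = ⊥-elim (<⇒≱ (m<n+m δ (>-nonZero⁻¹ a)) (begin
    a + δ                        ≤⟨ m≤m*n (a + δ) (suc j) ⟩
    (a + δ) * suc j              ≤⟨ m≤n+m _ _ ⟩
    k + a * i + (a + δ) * suc j  ≡⟨ eq ⟩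
    δ                            ∎))
    where open ≤-Reasoning
  step≡δ⇒ k zero zero a≤k⇒1≤i eq = ⊥-elim (<⇒≱ z<s (a≤k⇒1≤i (subst (a ≤_) (sym k≡δ) (<⇒≤ a<δ))))
    where
    k≡δ : k ≡ δ
    k≡δ = trans (sym (normalise k a (a + δ))) eq
      where
      normalise : ∀ k a b → k + a * 0 + b * 0 ≡ k
      normalise = solve-∀
  step≡δ⇒ k (suc zero) zero _ eq = k≡d , refl , refl
    where
    k≡d : k ≡ d
    k≡d = trans (sym (m+n∸n≡m k a)) (cong (_∸ a) (trans (sym (k+a*1+b*0≡k+a k a (a + δ))) eq))
  step≡δ⇒ k (suc (suc i)) zero _ eq = ⊥-elim (<⇒≱ δ<2a (begin
    2 * a                        ≡⟨ *-comm 2 a ⟩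
    a * 2                        ≤⟨ *-monoʳ-≤ a (s≤s (s≤s z≤n)) ⟩
    a * suc (suc i)              ≤⟨ m≤n+m _ k ⟩
    k + a * suc (suc i)          ≤⟨ m≤m+n _ _ ⟩
    k + a * suc (suc i) + (a + δ) * 0 ≡⟨ eq ⟩
    δ                            ∎))
    where open ≤-Reasoning

  w-gap-δ : ∀ n k → w a δ (n + k) ≡ w a δ n + δ → k ≡ d × Δ a n k ≡ 1 × Δ δ n k ≡ 0
  w-gap-δ n k eq = step≡δ⇒ k (Δ a n k) (Δ δ n k)
    (λ a≤k → ≤-trans (≤-reflexive (sym (Δ-self a n))) (Δ-monoʳ-≤ a n a≤k))
    (+-cancelˡ-≡ (w a δ n) _ _ (trans (sym (w-step a δ n k)) eq))

  Δδ-complement : ∀ n → Δ δ n d + Δ δ (n + d) a ≡ 1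
  Δδ-complement n = trans (sym (Δ-split δ n d a)) (trans (cong (Δ δ n) d+a≡δ) (Δ-self δ n))

  χ≤1 : ∀ n → χ a δ n ≤ 1
  χ≤1 n = *-mono-≤ (≤-trans (Δ-monoʳ-≤ a n d≤a) (≤-reflexive (Δ-self a n)))
                   (≤-trans (m≤n+m _ _) (≤-reflexive (Δδ-complement n)))

  χ≡1⇔ : ∀ n → χ a δ n ≡ 1 ⇔ (Δ a n d ≡ 1 × Δ δ n d ≡ 0)
  χ≡1⇔ n = mk⇔
    (λ χ≡1 → m*n≡1⇒m≡1 (Δ a n d) _ χ≡1 ,
      +-cancelʳ-≡ 1 _ 0 (trans (cong (Δ δ n d +_) (sym (m*n≡1⇒n≡1 (Δ a n d) _ χ≡1))) (Δδ-complement n)))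
    (λ (i≡1 , j≡0) → cong₂ _*_ i≡1 (trans (sym (cong (_+ Δ δ (n + d) a) j≡0)) (Δδ-complement n)))

  InC⇔ : ∀ x → InC a δ x ⇔ (∃ λ n → w a δ n ≡ x × χ a δ n ≡ 1)
  InC⇔ x = mk⇔ to from
    where
    open StrictlyIncreasing (w a δ) (w-strictMono a δ)
    to : InC a δ x → ∃ λ n → w a δ n ≡ x × χ a δ n ≡ 1
    to ((n , wn≡x) , (m , wm≡x+δ)) with w-gap-δ n (m ∸ n) gap
      where
      n<m : n < m
      n<m = cancel-< (subst₂ _<_ (sym wn≡x) (sym wm≡x+δ) (m<m+n x (>-nonZero⁻¹ δ)))
      gap : w a δ (n + (m ∸ n)) ≡ w a δ n + δ
      gap = trans (cong (w a δ) (m+[n∸m]≡n (<⇒≤ n<m))) (trans wm≡x+δ (cong (_+ δ) (sym wn≡x)))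
    ... | k≡d , i≡1 , j≡0 = n , wn≡x , Equivalence.from (χ≡1⇔ n)
      (subst (λ k → Δ a n k ≡ 1) k≡d i≡1 , subst (λ k → Δ δ n k ≡ 0) k≡d j≡0)
    from : (∃ λ n → w a δ n ≡ x × χ a δ n ≡ 1) → InC a δ x
    from (n , wn≡x , χ≡1) with Equivalence.to (χ≡1⇔ n) χ≡1
    ... | i≡1 , j≡0 = (n , wn≡x) , (n + d , w[n+d]≡x+δ)
      where
      w[n+d]≡x+δ : w a δ (n + d) ≡ x + δ
      w[n+d]≡x+δ = begin
        w a δ (n + d)
          ≡⟨ w-step a δ n d ⟩
        w a δ n + (d + a * Δ a n d + (a + δ) * Δ δ n d)
          ≡⟨ cong₂ (λ u v → u + (d + a * v + (a + δ) * Δ δ n d)) wn≡x i≡1 ⟩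
        x + (d + a * 1 + (a + δ) * Δ δ n d)
          ≡⟨ cong (λ v → x + (d + a * 1 + (a + δ) * v)) j≡0 ⟩
        x + (d + a * 1 + (a + δ) * 0)
          ≡⟨ cong (x +_) (trans (k+a*1+b*0≡k+a d a (a + δ)) d+a≡δ) ⟩
        x + δ ∎
        where open ≡-Reasoning

  C-in-window⇔ : ∀ {N H P} m → (∀ n → (N ≤ w a δ n × w a δ n < N + H) ⇔ (m ≤ n × n < m + P)) →
                 ∀ x → x ∈ map (w a δ) (C-indices a δ m P) ⇔ (N ≤ x × x < N + H × InC a δ x)
  C-in-window⇔ {N} {H} {P} m inWindow _ = mk⇔ to from
    where
    to : ∀ {x} → x ∈ map (w a δ) (C-indices a δ m P) → N ≤ x × x < N + H × InC a δ x
    to x∈ with ∈-map⁻ (w a δ) x∈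
    ... | n , n∈ , refl with ∈-filter⁻ (λ n → χ a δ n ≟ 1) n∈
    ... | n∈range , χ≡1 with Equivalence.from (inWindow n) (Equivalence.to (∈-applyUpTo-+ m P n) n∈range)
    ... | N≤wn , wn<N+H = N≤wn , wn<N+H , Equivalence.from (InC⇔ (w a δ n)) (n , refl , χ≡1)
    from : ∀ {x} → N ≤ x × x < N + H × InC a δ x → x ∈ map (w a δ) (C-indices a δ m P)
    from {x} (N≤x , x<N+H , x∈C) with Equivalence.to (InC⇔ x) x∈C
    ... | n , refl , χ≡1 = ∈-map⁺ (w a δ) (∈-filter⁺ (λ n → χ a δ n ≟ 1)
      (Equivalence.from (∈-applyUpTo-+ m P n) (Equivalence.to (inWindow n) (N≤x , x<N+H))) χ≡1)

theorem4p1 : (a δ : ℕ) → .{{_ : NonZero a}} → .{{_ : NonZero δ}} →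
    a < δ → δ < 2 * a → gcd a δ ≡ 1 →
    (N : ℕ) →
    HasCard (λ x → N ≤ x × x < N + (3 * δ + a) * a × InC a δ x) (a * (δ ∸ a))
theorem4p1 a δ a<δ δ<2a _ N
  with StrictlyIncreasing.window (w a δ) (w-strictMono a δ) (w-zero a δ) (w-periodic a δ) N
... | m , inWindow = map (w a δ) starts , unique , size , C-in-window⇔ a δ a<δ δ<2a m inWindow
  where
  starts : List ℕ
  starts = C-indices a δ m (δ * a)
  unique : Unique (map (w a δ) starts)
  unique = map⁺ (StrictlyIncreasing.injective (w a δ) (w-strictMono a δ))
             (filter⁺ (λ n → χ a δ n ≟ 1) (applyUpTo⁺₁ (m +_) (δ * a) (λ i<j _ → <⇒≢ (+-monoʳ-< m i<j))))
  size : length (map (w a δ) starts) ≡ a * (δ ∸ a)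
  size = begin
    length (map (w a δ) starts)  ≡⟨ length-map (w a δ) starts ⟩
    length starts                ≡⟨ length-filter-≡1 (χ a δ) (χ≤1 a δ a<δ δ<2a) (δ * a) (m +_) ⟩
    ∑[ i < δ * a ] χ a δ (m + i) ≡⟨ ∑-periodic (δ * a) (χ a δ) (χ-periodic a δ) m ⟩
    ∑[ i < δ * a ] χ a δ i       ≡⟨ ∑-χ a δ ⟩
    a * (δ ∸ a)                  ∎
    where open ≡-Reasoning
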